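{- The $2$-Laplacian $L^{(2)}_{K_n}$ of the complete graph $K_n$ on $n\ge1$ vertices is positive semi-definite if and only if $1\le n\le 18$.
   Context: For a simple graph $G$ with adjacency matrix $A_G$ and degree matrix $D_G$ (diagonal matrix of vertex degrees), let $A'=\frac{1}{12}\left(16A_G-A_G^2+D_G\right)$ and let $D'$ be the diagonal matrix whose $(i,i)$ entry is the sum of the entries of the $i$th row of $A'$. The $2$-Laplacian of $G$ is $L^{(2)}_G=D'-A'$.
   Formalization: Positive semi-definiteness of $L^{(2)}_{K_n}$ is tested only against vectors with rational entries rather than real ones. -}

module Defs where

open import Data.Nat using (ℕ; zero; suc)
open import Data.Fin using (Fin; zero; suc; _≟_)
open import Data.Bool using (Bool; true; false; if_then_else_)
open import Data.Integer using (+_)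
open import Data.Rational using (ℚ; 0ℚ; 1ℚ; _+_; _*_; _-_; _/_; _≤_)
open import Relation.Nullary using (does; yes; no)
open import Data.Empty using (⊥-elim)
open import Relation.Binary.PropositionalEquality using (_≡_; refl) renaming (sym to ≡-sym)

record SimpleGraph (n : ℕ) : Set where
  field
    Adj    : Fin n → Fin n → Bool
    sym    : ∀ i j → Adj i j ≡ Adj j i
    irrefl : ∀ i → Adj i i ≡ false
open SimpleGraph public

Matrix : ℕ → Set
Matrix n = Fin n → Fin n → ℚ

sumFin : (n : ℕ) → (Fin n → ℚ) → ℚ
sumFin zero    f = 0ℚ
sumFin (suc n) f = f zero + sumFin n (λ i → f (suc i))

boolℚ : Bool → ℚ
boolℚ true  = 1ℚ
boolℚ false = 0ℚ

adjMatrix : {n : ℕ} → SimpleGraph n → Matrix n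
adjMatrix G i j = boolℚ (Adj G i j)

_⊗_ : {n : ℕ} → Matrix n → Matrix n → Matrix n
_⊗_ {n} M N i j = sumFin n (λ k → M i k * N k j)

diag : {n : ℕ} → (Fin n → ℚ) → Matrix n
diag v i j = if does (i ≟ j) then v i else 0ℚ

degMatrix : {n : ℕ} → SimpleGraph n → Matrix n
degMatrix {n} G = diag (λ i → sumFin n (adjMatrix G i))

A′ : {n : ℕ} → SimpleGraph n → Matrix n
A′ G i j = (+ 1 / 12) * ((((+ 16 / 1) * A i j) - (A ⊗ A) i j) + degMatrix G i j)
  where A = adjMatrix G

D′ : {n : ℕ} → SimpleGraph n → Matrix n
D′ {n} G = diag (λ i → sumFin n (A′ G i))

twoLaplacian : {n : ℕ} → SimpleGraph n → Matrix n
twoLaplacian G i j = D′ G i j - A′ G i j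

quadForm : {n : ℕ} → Matrix n → (Fin n → ℚ) → ℚ
quadForm {n} M x = sumFin n (λ i → sumFin n (λ j → x i * M i j * x j))

PositiveSemiDefinite : {n : ℕ} → Matrix n → Set
PositiveSemiDefinite {n} M = (x : Fin n → ℚ) → 0ℚ ≤ quadForm M x

completeGraph : (n : ℕ) → SimpleGraph n
completeGraph n = record
  { Adj    = λ i j → if does (i ≟ j) then false else true
  ; sym    = symK
  ; irrefl = irreflK
  }
  where
  symK : ∀ (i j : Fin n) → (if does (i ≟ j) then false else true) ≡ (if does (j ≟ i) then false else true)
  symK i j with i ≟ j | j ≟ i
  ... | yes _ | yes _ = refl
  ... | no _  | no _  = refl
  ... | yes p | no q  = ⊥-elim (q (≡-sym p))
  ... | no p  | yes q = ⊥-elim (p (≡-sym q))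
  irreflK : ∀ (i : Fin n) → (if does (i ≟ i) then false else true) ≡ false
  irreflK i with i ≟ i
  ... | yes _ = refl
  ... | no p  = ⊥-elim (p refl)

{-# OPTIONS --safe #-}
-- With J the all-ones matrix, Kₙ has A = J − I and A² = (n − 2)J + I, hence A′ = w(J − I)
-- with w = (18 − n)/12 and L⁽²⁾ = w(nI − J).  Its quadratic form is
-- w(n Σ xᵢ² − (Σ xᵢ)²) = (w/2) Σᵢⱼ (xᵢ − xⱼ)², which is nonnegative when w ≥ 0, i.e. n ≤ 18;
-- for n ≥ 19 the unit vector e₀ gives w(n − 1) < 0.
module Submission where

open import Defs
open import Data.Nat using (ℕ; _≤_)
open import Function.Bundles using (_⇔_)

open import Algebra.Bundles using (CommutativeRing)
open import Data.Bool using (true; false; if_then_else_)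
open import Data.Fin using (Fin; zero; suc; _≟_)
import Data.Integer as ℤ
import Data.Nat as ℕ
import Data.Nat.Properties as ℕ
open import Data.Rational
  using (ℚ; 0ℚ; 1ℚ; _+_; _*_; _-_; -_; _/_; positive; nonNegative; nonPositive)
  renaming (_≤_ to _≤ℚ_; _<_ to _<ℚ_)
import Data.Rational.Properties as ℚ
open import Data.Rational.Solver using (module +-*-Solver)
open import Data.Sum using (inj₁; inj₂)
open import Function.Base using (_∘_)
open import Function.Bundles using (mk⇔)
open import Relation.Nullary using (¬_; does)
open import Relation.Nullary.Decidable using (decidable-stable)
open import Relation.Binary.PropositionalEquality as ≡
  using (_≡_; refl; trans; cong; cong₂; subst; module ≡-Reasoning)

open CommutativeRing ℚ.+-*-commutativeRing using (semiring)
open import Algebra.Properties.Semiring.Sum semiring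
  using (sum; sum-cong-≗; sum-replicate; sum-replicate-zero; ∑-distrib-+; *-distribˡ-sum)
open import Algebra.Properties.Semiring.Mult semiring using (_×_; ×-homo-+; ×-comm-*)
open +-*-Solver using (solve; _:=_; _:+_; _:*_; _:-_; :-_; con)
open ≡-Reasoning

sumFin≡sum : ∀ n (f : Fin n → ℚ) → sumFin n f ≡ sum f
sumFin≡sum ℕ.zero    f = refl
sumFin≡sum (ℕ.suc n) f = cong (f zero +_) (sumFin≡sum n (f ∘ suc))

sumFin-cong : ∀ n {f g : Fin n → ℚ} → (∀ i → f i ≡ g i) → sumFin n f ≡ sumFin n g
sumFin-cong ℕ.zero    f≡g = refl
sumFin-cong (ℕ.suc n) f≡g = cong₂ _+_ (f≡g zero) (sumFin-cong n (f≡g ∘ suc))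

∑-const : ∀ n (c : ℚ) → sum {n} (λ _ → c) ≡ c * (n × 1ℚ)
∑-const n c = begin
  sum {n} (λ _ → c)  ≡⟨ sum-replicate n ⟩
  n × c              ≡⟨ cong (n ×_) (ℚ.*-identityʳ c) ⟨
  n × (c * 1ℚ)       ≡⟨ ×-comm-* n c 1ℚ ⟨
  c * (n × 1ℚ)       ∎

∑-affine : ∀ {n} a b c (f g : Fin n → ℚ) →
           sum (λ k → a + (b * f k + c * g k)) ≡ a * (n × 1ℚ) + (b * sum f + c * sum g)
∑-affine {n} a b c f g = begin
  sum (λ k → a + (b * f k + c * g k))
    ≡⟨ ∑-distrib-+ (λ _ → a) (λ k → b * f k + c * g k) ⟩
  sum {n} (λ _ → a) + sum (λ k → b * f k + c * g k)
    ≡⟨ cong (sum {n} (λ _ → a) +_) (∑-distrib-+ (λ k → b * f k) (λ k → c * g k)) ⟩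
  sum {n} (λ _ → a) + (sum (λ k → b * f k) + sum (λ k → c * g k))
    ≡⟨ cong₂ _+_ (∑-const n a) (≡.sym (cong₂ _+_ (*-distribˡ-sum b f) (*-distribˡ-sum c g))) ⟩
  a * (n × 1ℚ) + (b * sum f + c * sum g) ∎

δ : ∀ {n} → Fin n → Fin n → ℚ
δ i j = if does (i ≟ j) then 1ℚ else 0ℚ

δ-sym : ∀ {n} (i j : Fin n) → δ i j ≡ δ j i
δ-sym zero    zero    = refl
δ-sym zero    (suc j) = refl
δ-sym (suc i) zero    = refl
δ-sym (suc i) (suc j) = δ-sym i j

∑-δ : ∀ {n} (i : Fin n) (f : Fin n → ℚ) → sum (λ k → δ i k * f k) ≡ f i
∑-δ {ℕ.suc n} zero f = begin
  1ℚ * f zero + sum (λ k → 0ℚ * f (suc k))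
    ≡⟨ cong₂ _+_ (ℚ.*-identityˡ (f zero)) (sum-cong-≗ (ℚ.*-zeroˡ ∘ f ∘ suc)) ⟩
  f zero + sum {n} (λ _ → 0ℚ)
    ≡⟨ cong (f zero +_) (sum-replicate-zero n) ⟩
  f zero + 0ℚ
    ≡⟨ ℚ.+-identityʳ (f zero) ⟩
  f zero ∎
∑-δ {ℕ.suc n} (suc i) f = begin
  0ℚ * f zero + sum (λ k → δ i k * f (suc k))
    ≡⟨ cong₂ _+_ (ℚ.*-zeroˡ (f zero)) (∑-δ i (f ∘ suc)) ⟩
  0ℚ + f (suc i)
    ≡⟨ ℚ.+-identityˡ (f (suc i)) ⟩
  f (suc i) ∎

δ-refl : ∀ {n} (i : Fin n) → δ i i ≡ 1ℚ
δ-refl zero    = refl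
δ-refl (suc i) = δ-refl i

∑-δ-row : ∀ {n} (i : Fin n) → sum (δ i) ≡ 1ℚ
∑-δ-row i = begin
  sum (δ i)                 ≡⟨ sum-cong-≗ (λ k → ℚ.*-identityʳ (δ i k)) ⟨
  sum (λ k → δ i k * 1ℚ)    ≡⟨ ∑-δ i (λ _ → 1ℚ) ⟩
  1ℚ                        ∎

infix 8 _I+_J
_I+_J : ∀ {n} → ℚ → ℚ → Matrix n
(a I+ b J) i j = a * δ i j + b

∑-I+J : ∀ {n} a b (i : Fin n) (f : Fin n → ℚ) →
        sum (λ k → (a I+ b J) i k * f k) ≡ a * f i + b * sum f
∑-I+J a b i f = begin
  sum (λ k → (a * δ i k + b) * f k)
    ≡⟨ sum-cong-≗ (λ k → distrib a b (δ i k) (f k)) ⟩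
  sum (λ k → a * (δ i k * f k) + b * f k)
    ≡⟨ ∑-distrib-+ (λ k → a * (δ i k * f k)) (λ k → b * f k) ⟩
  sum (λ k → a * (δ i k * f k)) + sum (λ k → b * f k)
    ≡⟨ cong₂ _+_ (*-distribˡ-sum a (λ k → δ i k * f k)) (*-distribˡ-sum b f) ⟨
  a * sum (λ k → δ i k * f k) + b * sum f
    ≡⟨ cong (λ s → a * s + b * sum f) (∑-δ i f) ⟩
  a * f i + b * sum f ∎
  where
  distrib : ∀ a b d x → (a * d + b) * x ≡ a * (d * x) + b * x
  distrib = solve 4 (λ a b d x → (a :* d :+ b) :* x := a :* (d :* x) :+ b :* x) refl

∑-I+J-row : ∀ {n} a b (i : Fin n) → sum ((a I+ b J) i) ≡ a + b * (n × 1ℚ)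
∑-I+J-row {n} a b i = begin
  sum ((a I+ b J) i)
    ≡⟨ sum-cong-≗ (λ k → ℚ.*-identityʳ ((a I+ b J) i k)) ⟨
  sum (λ k → (a I+ b J) i k * 1ℚ)
    ≡⟨ ∑-I+J a b i (λ _ → 1ℚ) ⟩
  a * 1ℚ + b * sum {n} (λ _ → 1ℚ)
    ≡⟨ cong₂ (λ x y → x + b * y) (ℚ.*-identityʳ a) (sum-replicate n) ⟩
  a + b * (n × 1ℚ) ∎

∑-I+J-column : ∀ {n} a b (j : Fin n) → sum (λ k → (a I+ b J) k j) ≡ a + b * (n × 1ℚ)
∑-I+J-column a b j =
  trans (sum-cong-≗ (λ k → cong (λ d → a * d + b) (δ-sym k j))) (∑-I+J-row a b j)

⊗-cong : ∀ {n} {M M′ N N′ : Matrix n} → (∀ i j → M i j ≡ M′ i j) → (∀ i j → N i j ≡ N′ i j) →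
         ∀ i j → (M ⊗ N) i j ≡ (M′ ⊗ N′) i j
⊗-cong {n} M≡M′ N≡N′ i j = sumFin-cong n (λ k → cong₂ _*_ (M≡M′ i k) (N≡N′ k j))

⊗-I+J : ∀ {n} a b a′ b′ (i j : Fin n) →
        ((a I+ b J) ⊗ (a′ I+ b′ J)) i j ≡ ((a * a′) I+ (a * b′ + b * (a′ + b′ * (n × 1ℚ))) J) i j
⊗-I+J {n} a b a′ b′ i j = begin
  sumFin n (λ k → (a I+ b J) i k * (a′ I+ b′ J) k j)
    ≡⟨ sumFin≡sum n _ ⟩
  sum (λ k → (a I+ b J) i k * (a′ I+ b′ J) k j)
    ≡⟨ ∑-I+J a b i (λ k → (a′ I+ b′ J) k j) ⟩
  a * (a′ * δ i j + b′) + b * sum (λ k → (a′ I+ b′ J) k j)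
    ≡⟨ cong (λ s → a * (a′ * δ i j + b′) + b * s) (∑-I+J-column a′ b′ j) ⟩
  a * (a′ * δ i j + b′) + b * (a′ + b′ * (n × 1ℚ))
    ≡⟨ regroup a a′ b′ (δ i j) (b * (a′ + b′ * (n × 1ℚ))) ⟩
  ((a * a′) I+ (a * b′ + b * (a′ + b′ * (n × 1ℚ))) J) i j ∎
  where
  regroup : ∀ a a′ b′ d t → a * (a′ * d + b′) + t ≡ (a * a′) * d + (a * b′ + t)
  regroup = solve 5 (λ a a′ b′ d t → a :* (a′ :* d :+ b′) :+ t
                                  := (a :* a′) :* d :+ (a :* b′ :+ t)) refl

diag≡*δ : ∀ {n} (v : Fin n → ℚ) (i j : Fin n) → diag v i j ≡ v i * δ i j
diag≡*δ v i j = entry (does (i ≟ j))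
  where
  entry : ∀ b → (if b then v i else 0ℚ) ≡ v i * (if b then 1ℚ else 0ℚ)
  entry true  = ≡.sym (ℚ.*-identityʳ (v i))
  entry false = ≡.sym (ℚ.*-zeroʳ (v i))

diag-rowSums-I+J : ∀ {n} {M : Matrix n} a b → (∀ i j → M i j ≡ (a I+ b J) i j) →
                   ∀ i j → diag (λ i → sumFin n (M i)) i j ≡ (a + b * (n × 1ℚ)) * δ i j
diag-rowSums-I+J {n} {M} a b M≡I+J i j = begin
  diag (λ i → sumFin n (M i)) i j  ≡⟨ diag≡*δ (λ i → sumFin n (M i)) i j ⟩
  sumFin n (M i) * δ i j           ≡⟨ cong (_* δ i j) (sumFin≡sum n (M i)) ⟩
  sum (M i) * δ i j                ≡⟨ cong (_* δ i j) (sum-cong-≗ (M≡I+J i)) ⟩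
  sum ((a I+ b J) i) * δ i j       ≡⟨ cong (_* δ i j) (∑-I+J-row a b i) ⟩
  (a + b * (n × 1ℚ)) * δ i j       ∎

quadForm-cong : ∀ {n} {M M′ : Matrix n} → (∀ i j → M i j ≡ M′ i j) →
                ∀ x → quadForm M x ≡ quadForm M′ x
quadForm-cong {n} M≡M′ x =
  sumFin-cong n (λ i → sumFin-cong n (λ j → cong (λ m → x i * m * x j) (M≡M′ i j)))

quadForm≡∑x*M·x : ∀ {n} (M : Matrix n) x → quadForm M x ≡ sum (λ i → x i * sum (λ j → M i j * x j))
quadForm≡∑x*M·x {n} M x = trans (sumFin-cong n row) (sumFin≡sum n _)
  where
  row : ∀ i → sumFin n (λ j → x i * M i j * x j) ≡ x i * sum (λ j → M i j * x j)
  row i = begin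
    sumFin n (λ j → x i * M i j * x j)    ≡⟨ sumFin≡sum n _ ⟩
    sum (λ j → x i * M i j * x j)         ≡⟨ sum-cong-≗ (λ j → ℚ.*-assoc (x i) (M i j) (x j)) ⟩
    sum (λ j → x i * (M i j * x j))       ≡⟨ *-distribˡ-sum (x i) (λ j → M i j * x j) ⟨
    x i * sum (λ j → M i j * x j)         ∎

quadForm-I+J : ∀ {n} a b (x : Fin n → ℚ) →
               quadForm (a I+ b J) x ≡ a * sum (λ i → x i * x i) + b * (sum x * sum x)
quadForm-I+J a b x = begin
  quadForm (a I+ b J) x
    ≡⟨ quadForm≡∑x*M·x (a I+ b J) x ⟩
  sum (λ i → x i * sum (λ j → (a I+ b J) i j * x j))
    ≡⟨ sum-cong-≗ (λ i → cong (x i *_) (∑-I+J a b i x)) ⟩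
  sum (λ i → x i * (a * x i + b * sum x))
    ≡⟨ sum-cong-≗ (λ i → expand a (b * sum x) (x i)) ⟩
  sum (λ i → a * (x i * x i) + (b * sum x) * x i)
    ≡⟨ ∑-distrib-+ (λ i → a * (x i * x i)) (λ i → (b * sum x) * x i) ⟩
  sum (λ i → a * (x i * x i)) + sum (λ i → (b * sum x) * x i)
    ≡⟨ cong₂ _+_ (*-distribˡ-sum a (λ i → x i * x i)) (*-distribˡ-sum (b * sum x) x) ⟨
  a * sum (λ i → x i * x i) + (b * sum x) * sum x
    ≡⟨ cong (a * sum (λ i → x i * x i) +_) (ℚ.*-assoc b (sum x) (sum x)) ⟩
  a * sum (λ i → x i * x i) + b * (sum x * sum x) ∎
  where
  expand : ∀ a c y → y * (a * y + c) ≡ a * (y * y) + c * y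
  expand = solve 3 (λ a c y → y :* (a :* y :+ c) := a :* (y :* y) :+ c :* y) refl

lagrange-identity : ∀ {n} (x : Fin n → ℚ) →
  (n × 1ℚ) * sum (λ i → x i * x i) - sum x * sum x
    ≡ (ℤ.+ 1 / 2) * sum (λ i → sum (λ j → (x i - x j) * (x i - x j)))
lagrange-identity {n} x = ≡.sym (begin
  ½ * sum (λ i → sum (λ j → (x i - x j) * (x i - x j)))
    ≡⟨ cong (½ *_) (sum-cong-≗ row) ⟩
  ½ * sum (λ i → (x i * x i) * N + (1ℚ * Sx² + (-2ℚ * x i) * Sx))
    ≡⟨ cong (½ *_) (sum-cong-≗ (λ i → swap (x i) N Sx² Sx)) ⟩
  ½ * sum (λ i → Sx² + (N * (x i * x i) + (-2ℚ * Sx) * x i))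
    ≡⟨ cong (½ *_) (∑-affine Sx² N (-2ℚ * Sx) (λ i → x i * x i) x) ⟩
  ½ * (Sx² * N + (N * Sx² + (-2ℚ * Sx) * Sx))
    ≡⟨ halve N Sx² Sx ⟩
  N * Sx² - Sx * Sx ∎)
  where
  ½ N Sx Sx² : ℚ
  ½ = ℤ.+ 1 / 2
  -2ℚ : ℚ
  -2ℚ = - (ℤ.+ 2 / 1)
  N = n × 1ℚ
  Sx = sum x
  Sx² = sum (λ i → x i * x i)
  expand : ∀ y z → (y - z) * (y - z) ≡ y * y + (1ℚ * (z * z) + (-2ℚ * y) * z)
  expand = solve 2 (λ y z → (y :- z) :* (y :- z)
                         := y :* y :+ (con 1ℚ :* (z :* z) :+ (:- con (ℤ.+ 2 / 1) :* y) :* z)) refl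
  row : ∀ i → sum (λ j → (x i - x j) * (x i - x j)) ≡ (x i * x i) * N + (1ℚ * Sx² + (-2ℚ * x i) * Sx)
  row i = trans (sum-cong-≗ (λ j → expand (x i) (x j)))
                (∑-affine (x i * x i) 1ℚ (-2ℚ * x i) (λ j → x j * x j) x)
  swap : ∀ y N Q S → (y * y) * N + (1ℚ * Q + (-2ℚ * y) * S) ≡ Q + (N * (y * y) + (-2ℚ * S) * y)
  swap = solve 4 (λ y N Q S → (y :* y) :* N :+ (con 1ℚ :* Q :+ (:- con (ℤ.+ 2 / 1) :* y) :* S)
                           := Q :+ (N :* (y :* y) :+ (:- con (ℤ.+ 2 / 1) :* S) :* y)) refl
  halve : ∀ N Q S → ½ * (Q * N + (N * Q + (-2ℚ * S) * S)) ≡ N * Q - S * S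
  halve = solve 3 (λ N Q S → con (ℤ.+ 1 / 2) :* (Q :* N :+ (N :* Q :+ (:- con (ℤ.+ 2 / 1) :* S) :* S))
                          := N :* Q :- S :* S) refl

sum-nonneg : ∀ {n} (f : Fin n → ℚ) → (∀ i → 0ℚ ≤ℚ f i) → 0ℚ ≤ℚ sum f
sum-nonneg {ℕ.zero}  f 0≤f = ℚ.≤-refl
sum-nonneg {ℕ.suc n} f 0≤f = ℚ.+-mono-≤ (0≤f zero) (sum-nonneg (f ∘ suc) (0≤f ∘ suc))

×1-nonneg : ∀ n → 0ℚ ≤ℚ n × 1ℚ
×1-nonneg ℕ.zero    = ℚ.≤-refl
×1-nonneg (ℕ.suc n) = ℚ.+-mono-≤ (ℚ.nonNegative⁻¹ 1ℚ) (×1-nonneg n)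

*-nonneg : ∀ {p q} → 0ℚ ≤ℚ p → 0ℚ ≤ℚ q → 0ℚ ≤ℚ p * q
*-nonneg {p} {q} 0≤p 0≤q =
  ℚ.nonNegative⁻¹ (p * q) {{ℚ.nonNeg*nonNeg⇒nonNeg p {{nonNegative 0≤p}} q {{nonNegative 0≤q}}}}

*-pos : ∀ {p q} → 0ℚ <ℚ p → 0ℚ <ℚ q → 0ℚ <ℚ p * q
*-pos {p} {q} 0<p 0<q = ℚ.positive⁻¹ (p * q) {{ℚ.pos*pos⇒pos p {{positive 0<p}} q {{positive 0<q}}}}

square-nonneg : ∀ p → 0ℚ ≤ℚ p * p
square-nonneg p with ℚ.≤-total 0ℚ p
... | inj₁ 0≤p = *-nonneg 0≤p 0≤p
... | inj₂ p≤0 =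
  ℚ.nonNegative⁻¹ (p * p) {{ℚ.nonPos*nonPos⇒nonPos p {{nonPositive p≤0}} p {{nonPositive p≤0}}}}

lagrange-nonneg : ∀ {n} (x : Fin n → ℚ) → 0ℚ ≤ℚ (n × 1ℚ) * sum (λ i → x i * x i) - sum x * sum x
lagrange-nonneg x = subst (0ℚ ≤ℚ_) (≡.sym (lagrange-identity x))
  (*-nonneg (ℚ.nonNegative⁻¹ (ℤ.+ 1 / 2))
            (sum-nonneg _ (λ i → sum-nonneg _ (λ j → square-nonneg (x i - x j)))))

adjMatrix-complete : ∀ {n} (i j : Fin n) → adjMatrix (completeGraph n) i j ≡ ((- 1ℚ) I+ 1ℚ J) i j
adjMatrix-complete i j = entry (does (i ≟ j))
  where
  entry : ∀ b → boolℚ (if b then false else true) ≡ (- 1ℚ) * (if b then 1ℚ else 0ℚ) + 1ℚ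
  entry true  = refl
  entry false = refl

adjMatrix²-complete : ∀ {n} (i j : Fin n) →
  (adjMatrix (completeGraph n) ⊗ adjMatrix (completeGraph n)) i j ≡ (1ℚ I+ (n × 1ℚ - ℤ.+ 2 / 1) J) i j
adjMatrix²-complete {n} i j = begin
  (adjMatrix (completeGraph n) ⊗ adjMatrix (completeGraph n)) i j
    ≡⟨ ⊗-cong adjMatrix-complete adjMatrix-complete i j ⟩
  (((- 1ℚ) I+ 1ℚ J) ⊗ ((- 1ℚ) I+ 1ℚ J)) i j
    ≡⟨ ⊗-I+J (- 1ℚ) 1ℚ (- 1ℚ) 1ℚ i j ⟩
  (1ℚ I+ (- 1ℚ * 1ℚ + 1ℚ * (- 1ℚ + 1ℚ * (n × 1ℚ))) J) i j
    ≡⟨ cong (λ b → (1ℚ I+ b J) i j) (simplify (n × 1ℚ)) ⟩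
  (1ℚ I+ (n × 1ℚ - ℤ.+ 2 / 1) J) i j ∎
  where
  simplify : ∀ N → - 1ℚ * 1ℚ + 1ℚ * (- 1ℚ + 1ℚ * N) ≡ N - ℤ.+ 2 / 1
  simplify = solve 1 (λ N → :- con 1ℚ :* con 1ℚ :+ con 1ℚ :* (:- con 1ℚ :+ con 1ℚ :* N)
                          := N :- con (ℤ.+ 2 / 1)) refl

degMatrix-complete : ∀ {n} (i j : Fin n) → degMatrix (completeGraph n) i j ≡ (n × 1ℚ - 1ℚ) * δ i j
degMatrix-complete {n} i j = trans (diag-rowSums-I+J (- 1ℚ) 1ℚ adjMatrix-complete i j)
  (cong (_* δ i j) (simplify (n × 1ℚ)))
  where
  simplify : ∀ N → - 1ℚ + 1ℚ * N ≡ N - 1ℚ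
  simplify = solve 1 (λ N → :- con 1ℚ :+ con 1ℚ :* N := N :- con 1ℚ) refl

edgeWeight : ℕ → ℚ
edgeWeight n = (ℤ.+ 1 / 12) * (ℤ.+ 18 / 1 - n × 1ℚ)

A′-complete : ∀ {n} (i j : Fin n) → A′ (completeGraph n) i j ≡ ((- edgeWeight n) I+ edgeWeight n J) i j
A′-complete {n} i j =
  trans (cong₂ (λ x y → (ℤ.+ 1 / 12) * (x + y))
               (cong₂ (λ a a² → (ℤ.+ 16 / 1) * a - a²) (adjMatrix-complete i j) (adjMatrix²-complete i j))
               (degMatrix-complete i j))
        (collect (δ i j) (n × 1ℚ))
  where
  collect : ∀ d N →
    (ℤ.+ 1 / 12) * (((ℤ.+ 16 / 1) * (- 1ℚ * d + 1ℚ) - (1ℚ * d + (N - ℤ.+ 2 / 1))) + (N - 1ℚ) * d)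
    ≡ - ((ℤ.+ 1 / 12) * (ℤ.+ 18 / 1 - N)) * d + (ℤ.+ 1 / 12) * (ℤ.+ 18 / 1 - N)
  collect = solve 2 (λ d N →
    con (ℤ.+ 1 / 12) :* ((con (ℤ.+ 16 / 1) :* (:- con 1ℚ :* d :+ con 1ℚ)
                          :- (con 1ℚ :* d :+ (N :- con (ℤ.+ 2 / 1))))
                         :+ (N :- con 1ℚ) :* d)
    := :- (con (ℤ.+ 1 / 12) :* (con (ℤ.+ 18 / 1) :- N)) :* d
       :+ con (ℤ.+ 1 / 12) :* (con (ℤ.+ 18 / 1) :- N)) refl

twoLaplacian-complete : ∀ {n} (i j : Fin n) →
  twoLaplacian (completeGraph n) i j ≡ ((edgeWeight n * (n × 1ℚ)) I+ (- edgeWeight n) J) i j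
twoLaplacian-complete {n} i j =
  trans (cong₂ _-_ (diag-rowSums-I+J (- w) w A′-complete i j) (A′-complete i j))
        (collect w (n × 1ℚ) (δ i j))
  where
  w : ℚ
  w = edgeWeight n
  collect : ∀ w N d → (- w + w * N) * d - (- w * d + w) ≡ (w * N) * d + - w
  collect = solve 3 (λ w N d → (:- w :+ w :* N) :* d :- (:- w :* d :+ w) := (w :* N) :* d :+ :- w) refl

quadForm-twoLaplacian-complete : ∀ {n} (x : Fin n → ℚ) →
  quadForm (twoLaplacian (completeGraph n)) x
    ≡ edgeWeight n * ((n × 1ℚ) * sum (λ i → x i * x i) - sum x * sum x)
quadForm-twoLaplacian-complete {n} x = begin
  quadForm (twoLaplacian (completeGraph n)) x             ≡⟨ quadForm-cong twoLaplacian-complete x ⟩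
  quadForm ((w * N) I+ (- w) J) x                         ≡⟨ quadForm-I+J (w * N) (- w) x ⟩
  (w * N) * Sx² + (- w) * (Sx * Sx)                       ≡⟨ factor w N Sx² (Sx * Sx) ⟩
  w * (N * Sx² - Sx * Sx)                                 ∎
  where
  w N Sx Sx² : ℚ
  w = edgeWeight n
  N = n × 1ℚ
  Sx = sum x
  Sx² = sum (λ i → x i * x i)
  factor : ∀ w N Q P → (w * N) * Q + (- w) * P ≡ w * (N * Q - P)
  factor = solve 4 (λ w N Q P → (w :* N) :* Q :+ (:- w) :* P := w :* (N :* Q :- P)) refl

quadForm-twoLaplacian-complete-δ : ∀ {n} (i : Fin n) →
  quadForm (twoLaplacian (completeGraph n)) (δ i) ≡ edgeWeight n * (n × 1ℚ - 1ℚ)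
quadForm-twoLaplacian-complete-δ {n} i = begin
  quadForm (twoLaplacian (completeGraph n)) (δ i)
    ≡⟨ quadForm-twoLaplacian-complete (δ i) ⟩
  edgeWeight n * ((n × 1ℚ) * sum (λ k → δ i k * δ i k) - sum (δ i) * sum (δ i))
    ≡⟨ cong₂ (λ Q S → edgeWeight n * ((n × 1ℚ) * Q - S * S)) (trans (∑-δ i (δ i)) (δ-refl i)) (∑-δ-row i) ⟩
  edgeWeight n * ((n × 1ℚ) * 1ℚ - 1ℚ * 1ℚ)
    ≡⟨ cong (λ N → edgeWeight n * (N - 1ℚ)) (ℚ.*-identityʳ (n × 1ℚ)) ⟩
  edgeWeight n * (n × 1ℚ - 1ℚ) ∎

edgeWeight-nonneg : ∀ {n} → n ≤ 18 → 0ℚ ≤ℚ edgeWeight n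
edgeWeight-nonneg {n} n≤18 =
  *-nonneg (ℚ.nonNegative⁻¹ (ℤ.+ 1 / 12)) (subst (0ℚ ≤ℚ_) (≡.sym 18-n≡k) (×1-nonneg k))
  where
  k : ℕ
  k = 18 ℕ.∸ n
  18-n≡k : ℤ.+ 18 / 1 - n × 1ℚ ≡ k × 1ℚ
  18-n≡k = begin
    ℤ.+ 18 / 1 - n × 1ℚ               ≡⟨ cong (λ m → m × 1ℚ - n × 1ℚ) (ℕ.m+[n∸m]≡n n≤18) ⟨
    (n ℕ.+ k) × 1ℚ - n × 1ℚ           ≡⟨ cong (_- n × 1ℚ) (×-homo-+ 1ℚ n k) ⟩
    (n × 1ℚ + k × 1ℚ) - n × 1ℚ        ≡⟨ cancel (n × 1ℚ) (k × 1ℚ) ⟩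
    k × 1ℚ                            ∎
    where
    cancel : ∀ a b → (a + b) - a ≡ b
    cancel = solve 2 (λ a b → (a :+ b) :- a := b) refl

twoLaplacian-complete-psd : ∀ {n} → n ≤ 18 → PositiveSemiDefinite (twoLaplacian (completeGraph n))
twoLaplacian-complete-psd n≤18 x = subst (0ℚ ≤ℚ_) (≡.sym (quadForm-twoLaplacian-complete x))
  (*-nonneg (edgeWeight-nonneg n≤18) (lagrange-nonneg x))

twoLaplacian-complete-not-psd : ∀ k → ¬ PositiveSemiDefinite (twoLaplacian (completeGraph (19 ℕ.+ k)))
twoLaplacian-complete-not-psd k psd = ℚ.<-irrefl refl (ℚ.<-≤-trans form<0 (psd (δ zero)))
  where
  K : ℚ
  K = k × 1ℚ
  collect : ∀ K → (ℤ.+ 1 / 12) * (ℤ.+ 18 / 1 - (ℤ.+ 19 / 1 + K)) * ((ℤ.+ 19 / 1 + K) - 1ℚ)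
                  ≡ - ((ℤ.+ 1 / 12) * ((1ℚ + K) * (ℤ.+ 18 / 1 + K)))
  collect = solve 1 (λ K → con (ℤ.+ 1 / 12) :* (con (ℤ.+ 18 / 1) :- (con (ℤ.+ 19 / 1) :+ K))
                             :* ((con (ℤ.+ 19 / 1) :+ K) :- con 1ℚ)
                           := :- (con (ℤ.+ 1 / 12) :* ((con 1ℚ :+ K) :* (con (ℤ.+ 18 / 1) :+ K)))) refl
  form≡ : quadForm (twoLaplacian (completeGraph (19 ℕ.+ k))) (δ zero)
          ≡ - ((ℤ.+ 1 / 12) * ((1ℚ + K) * (ℤ.+ 18 / 1 + K)))
  form≡ = begin
    quadForm (twoLaplacian (completeGraph (19 ℕ.+ k))) (δ zero)
      ≡⟨ quadForm-twoLaplacian-complete-δ {19 ℕ.+ k} zero ⟩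
    edgeWeight (19 ℕ.+ k) * ((19 ℕ.+ k) × 1ℚ - 1ℚ)
      ≡⟨ cong (λ N → (ℤ.+ 1 / 12) * (ℤ.+ 18 / 1 - N) * (N - 1ℚ)) (×-homo-+ 1ℚ 19 k) ⟩
    (ℤ.+ 1 / 12) * (ℤ.+ 18 / 1 - (ℤ.+ 19 / 1 + K)) * ((ℤ.+ 19 / 1 + K) - 1ℚ)
      ≡⟨ collect K ⟩
    - ((ℤ.+ 1 / 12) * ((1ℚ + K) * (ℤ.+ 18 / 1 + K))) ∎
  form<0 : quadForm (twoLaplacian (completeGraph (19 ℕ.+ k))) (δ zero) <ℚ 0ℚ
  form<0 = subst (_<ℚ 0ℚ) (≡.sym form≡) (ℚ.neg-antimono-<
    (*-pos (ℚ.positive⁻¹ (ℤ.+ 1 / 12))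
           (*-pos (ℚ.+-mono-<-≤ (ℚ.positive⁻¹ 1ℚ) (×1-nonneg k))
                  (ℚ.+-mono-<-≤ (ℚ.positive⁻¹ (ℤ.+ 18 / 1)) (×1-nonneg k)))))

corollary6p14 : (n : ℕ) → 1 ≤ n →
    (PositiveSemiDefinite (twoLaplacian (completeGraph n)) ⇔ n ≤ 18)
corollary6p14 n _ = mk⇔ psd⇒n≤18 twoLaplacian-complete-psd
  where
  psd⇒n≤18 : PositiveSemiDefinite (twoLaplacian (completeGraph n)) → n ≤ 18
  psd⇒n≤18 psd = decidable-stable (n ℕ.≤? 18) λ n≰18 →
    twoLaplacian-complete-not-psd (n ℕ.∸ 19)
      (subst (PositiveSemiDefinite ∘ twoLaplacian ∘ completeGraph)
             (≡.sym (ℕ.m+[n∸m]≡n (ℕ.≰⇒> n≰18))) psd)
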